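{- Let $C_4$ be the cycle on $4$ vertices. For all sufficiently large $n$, every separating set for $\mathrm{Hom}_{C_4,n}$ has size at most $n^2$.
   Context: $\mathrm{Hom}_{H,n}=\sum_{\phi}\prod_{e\in E(H)}x_{\phi(e)}$ is the polynomial in variables $x_{\{u,v\}}$ ($u\ne v\in[n]$), where $\phi$ ranges over all graph homomorphisms $H\to K_n$ (maps $V(H)\to[n]$ sending edges to edges) and $\phi(\{i,j\})=\{\phi(i),\phi(j)\}$. A separating set for a polynomial $p$ is a set $S$ of monomials of $p$ such that for any two monomials $s,t\in S$ there is no monomial $m$ of $p$ dividing the product $st$. -}

module Defs where

open import Data.Nat using (ℕ; _+_; _≤_)
open import Data.Fin using (Fin; zero; suc; _≟_)
open import Data.Product using (Σ; _×_; _,_)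
open import Data.Sum using (_⊎_)
open import Data.List using (List; []; _∷_; length; filter)
open import Data.List.Relation.Unary.All using (All)
open import Data.List.Relation.Unary.AllPairs using (AllPairs)
open import Relation.Binary.PropositionalEquality using (_≡_; _≢_)
open import Relation.Nullary using (¬_)
open import Relation.Nullary.Decidable using (_×-dec_; _⊎-dec_)

-- A finite graph H: vertex set Fin V, edges given as a list of (unordered) pairs,
-- each listed once as an ordered pair.
record Graph : Set where
  constructor mkGraph
  field
    V : ℕ
    E : List (Fin V × Fin V)
open Graph public

C4 : Graph
C4 = mkGraph 4 ((zero , suc zero) ∷ (suc zero , suc (suc zero)) ∷
                (suc (suc zero) , suc (suc (suc zero))) ∷ (suc (suc (suc zero)) , zero) ∷ [])

-- Graph homomorphisms H → K_n: maps V(H) → [n] sending edges to edges (distinct endpoints).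
IsHom : (H : Graph) (n : ℕ) → (Fin (V H) → Fin n) → Set
IsHom H n φ = All (λ { (a , b) → φ a ≢ φ b }) (E H)

-- A monomial in the variables x_{u,v} (u ≠ v ∈ [n]) is encoded by its exponent
-- function on ordered pairs; m i j is the exponent of x_{{i,j}} (the encodings
-- used below are symmetric in i, j).
Monomial : ℕ → Set
Monomial n = Fin n → Fin n → ℕ

_≈ₘ_ : ∀ {n} → Monomial n → Monomial n → Set
s ≈ₘ t = ∀ i j → s i j ≡ t i j

_*ₘ_ : ∀ {n} → Monomial n → Monomial n → Monomial n
(s *ₘ t) i j = s i j + t i j

_∣ₘ_ : ∀ {n} → Monomial n → Monomial n → Set
m ∣ₘ s = ∀ i j → m i j ≤ s i j

-- The monomial ∏_{e ∈ E(H)} x_{φ(e)}: exponent of x_{{i,j}} is the number of edges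
-- {a,b} of H with {φ a, φ b} = {i, j}.
homMonomial : (H : Graph) (n : ℕ) → (Fin (V H) → Fin n) → Monomial n
homMonomial H n φ i j =
  length (filter (λ { (a , b) → ((φ a ≟ i) ×-dec (φ b ≟ j)) ⊎-dec ((φ a ≟ j) ×-dec (φ b ≟ i)) }) (E H))

-- m is a monomial of Hom_{H,n} (all coefficients are positive counts of homomorphisms).
IsMonomialOfHom : (H : Graph) (n : ℕ) → Monomial n → Set
IsMonomialOfHom H n m = Σ (Fin (V H) → Fin n) λ φ → IsHom H n φ × (m ≈ₘ homMonomial H n φ)

IsSeparatingSet : (H : Graph) (n : ℕ) → List (Monomial n) → Set
IsSeparatingSet H n S =
  All (IsMonomialOfHom H n) S ×
  AllPairs (λ s t → ¬ (s ≈ₘ t) ×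
                    (∀ m → IsMonomialOfHom H n m → m ∣ₘ (s *ₘ t) → (m ≈ₘ s) ⊎ (m ≈ₘ t))) S

-- Every monomial of Hom_{C4,n} is the product of two 2-paths a–b–c and c–d–a between
-- opposite corners a, c of the walk, and a 2-path of s glued to a 2-path of t with the same
-- endpoints is again a closed 4-walk whose monomial divides s·t. Label s by its corners
-- (a, c), oriented a ≤ c, when its middle vertices b, d differ, and by (b, a) with a < b when
-- s = x_{ab}⁴; these two kinds of labels never meet. If separated s, t share the corners
-- a, c but not the middle pair, pick x ∈ {b, d} \ {e, f} and y ∈ {e, f} \ {b, d}: the walk
-- a x c y gives a third divisor of s·t, containing the edge cy missing from s and the edge
-- ax missing from t.
-- So labelling is injective on a separating set, which thus has at most n² elements.
module Submission where

open import Data.Bool using (if_then_else_)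
open import Data.Empty using (⊥-elim)
open import Data.Fin using (Fin; zero; suc; _≟_; combine) renaming (_≤_ to _≤ᶠ_; _<_ to _<ᶠ_)
open import Data.Fin.Properties using (≤-total; <-cmp; injective⇒≤; combine-injective)
  renaming (≤-refl to ≤ᶠ-refl)
open import Data.List using (List; []; _∷_; length; filter; lookup)
open import Data.List.Membership.Propositional.Properties using (∈-lookup)
open import Data.List.Relation.Unary.All as All using (All; []; _∷_)
open import Data.List.Relation.Unary.AllPairs using (AllPairs; []; _∷_)
open import Data.Nat using (ℕ; zero; suc; _+_; _*_; _≤_; _^_)
open import Data.Nat.Properties using (+-comm; *-identityʳ; m≤m+n; m≤n+m; <⇒≱; +-mono-≤; ≤-trans)
open import Data.Nat.Tactic.RingSolver using (solve-∀)
open import Data.Product using (Σ; _×_; _,_; ∃₂; uncurry)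
open import Data.Sum using (_⊎_; inj₁; inj₂; [_,_]′)
import Data.Sum as Sum
open import Function using (_∘_)
open import Function.Bundles using (mk⇔)
open import Relation.Binary using (DecidableEquality; tri<; tri≈; tri>)
open import Relation.Binary.PropositionalEquality
open import Relation.Nullary using (¬_; Dec; yes; no; does)
open import Relation.Nullary.Decidable using (_×-dec_; _⊎-dec_; dec-true; dec-false; does-⇔)

open import Defs

length-filter-∷ : ∀ {A : Set} {P : A → Set} (P? : ∀ x → Dec (P x)) x xs →
  length (filter P? (x ∷ xs)) ≡ (if does (P? x) then 1 else 0) + length (filter P? xs)
length-filter-∷ P? x xs with P? x
... | yes _ = refl
... | no _  = refl

lookup-injective : ∀ {A : Set} {xs : List A} → AllPairs _≢_ xs → ∀ i j → lookup xs i ≡ lookup xs j → i ≡ j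
lookup-injective (_ ∷ _)     zero    zero    _  = refl
lookup-injective (x∉xs ∷ _)  zero    (suc j) eq = ⊥-elim (All.lookup x∉xs (∈-lookup j) eq)
lookup-injective (x∉xs ∷ _)  (suc i) zero    eq = ⊥-elim (All.lookup x∉xs (∈-lookup i) (sym eq))
lookup-injective (_ ∷ xs!)   (suc i) (suc j) eq = cong suc (lookup-injective xs! i j eq)

uncurry-combine-injective : ∀ {m k} (p q : Fin m × Fin k) → uncurry combine p ≡ uncurry combine q → p ≡ q
uncurry-combine-injective (i , j) (k , l) eq with refl , refl ← combine-injective i j k l eq = refl

distinct-length≤ : ∀ {k} {xs : List (Fin k)} → AllPairs _≢_ xs → length xs ≤ k
distinct-length≤ xs! = injective⇒≤ (lookup-injective xs! _ _)

module _ {A : Set} {P : A → Set} {R : A → A → Set} {k : ℕ} (label : ∀ {x} → P x → Fin k)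
         (label-separates : ∀ {x y} (px : P x) (py : P y) → R x y → label px ≢ label py) where

  labels-distinct : ∀ {xs} (pxs : All P xs) → AllPairs R xs → AllPairs _≢_ (All.reduce label pxs)
  labels-distinct []         []           = []
  labels-distinct (px ∷ pxs) (Rxys ∷ Rys) = head-distinct pxs Rxys ∷ labels-distinct pxs Rys
    where
    head-distinct : ∀ {ys} (pys : All P ys) → All (R _) ys → All (label px ≢_) (All.reduce label pys)
    head-distinct []         []          = []
    head-distinct (py ∷ pys) (Rxy ∷ Rxys) = label-separates px py Rxy ∷ head-distinct pys Rxys

  length-reduce : ∀ {xs} (pxs : All P xs) → length (All.reduce label pxs) ≡ length xs
  length-reduce []         = refl
  length-reduce (_ ∷ pxs) = cong suc (length-reduce pxs)

  length≤-by-separating-label : ∀ {xs} → All P xs → AllPairs R xs → length xs ≤ k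
  length≤-by-separating-label pxs Rxs =
    subst (_≤ k) (length-reduce pxs) (distinct-length≤ (labels-distinct pxs Rxs))

Among : ∀ {A : Set} → A → A → A → Set
Among x b d = x ≡ b ⊎ x ≡ d

among-≢ : ∀ {A : Set} {x b d z : A} → Among x b d → b ≢ z → d ≢ z → x ≢ z
among-≢ (inj₁ refl) b≢z _ = b≢z
among-≢ (inj₂ refl) _ d≢z = d≢z

Crossing : ∀ {A : Set} → A → A → A → A → Set
Crossing b d e f = ∃₂ λ x y → Among x b d × ¬ Among x e f × Among y e f × ¬ Among y b d

pairs-equal-or-crossing : ∀ {A : Set} → DecidableEquality A → {b d e f : A} → b ≢ d → e ≢ f →
  (e ≡ b × f ≡ d) ⊎ (e ≡ d × f ≡ b) ⊎ Crossing b d e f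
pairs-equal-or-crossing _≟ₐ_ {b} {d} {e} {f} b≢d e≢f with e ≟ₐ b | f ≟ₐ d | e ≟ₐ d | f ≟ₐ b
... | yes e≡b  | yes f≡d | _        | _        = inj₁ (e≡b , f≡d)
... | _        | _       | yes e≡d  | yes f≡b  = inj₂ (inj₁ (e≡d , f≡b))
... | yes refl | no f≢d  | _        | _        =
  inj₂ (inj₂ (d , f , inj₂ refl , [ ≢-sym b≢d , ≢-sym f≢d ]′ , inj₂ refl , [ ≢-sym e≢f , f≢d ]′))
... | no e≢b   | yes refl | _       | _        =
  inj₂ (inj₂ (b , e , inj₁ refl , [ ≢-sym e≢b , b≢d ]′ , inj₁ refl , [ e≢b , e≢f ]′))
... | no _     | no f≢d  | yes refl | no f≢b   =
  inj₂ (inj₂ (b , f , inj₁ refl , [ b≢d , ≢-sym f≢b ]′ , inj₂ refl , [ f≢b , f≢d ]′))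
... | no e≢b   | no _    | no e≢d   | yes refl =
  inj₂ (inj₂ (d , e , inj₂ refl , [ ≢-sym e≢d , ≢-sym b≢d ]′ , inj₁ refl , [ e≢b , e≢d ]′))
... | no e≢b   | no _    | no e≢d   | no f≢b   =
  inj₂ (inj₂ (b , e , inj₁ refl , [ ≢-sym e≢b , ≢-sym f≢b ]′ , inj₁ refl , [ e≢b , e≢d ]′))

module _ {n : ℕ} where

  ≈ₘ-refl : {s : Monomial n} → s ≈ₘ s
  ≈ₘ-refl i j = refl

  ≈ₘ-sym : {s t : Monomial n} → s ≈ₘ t → t ≈ₘ s
  ≈ₘ-sym s≈t i j = sym (s≈t i j)

  ≈ₘ-trans : {s t u : Monomial n} → s ≈ₘ t → t ≈ₘ u → s ≈ₘ u
  ≈ₘ-trans s≈t t≈u i j = trans (s≈t i j) (t≈u i j)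

  ∣ₘ-*ˡ : (s t : Monomial n) → s ∣ₘ (s *ₘ t)
  ∣ₘ-*ˡ s t i j = m≤m+n (s i j) (t i j)

  ∣ₘ-*ʳ : (s t : Monomial n) → t ∣ₘ (s *ₘ t)
  ∣ₘ-*ʳ s t i j = m≤n+m (t i j) (s i j)

  *ₘ-mono-∣ₘ : {p q s t : Monomial n} → p ∣ₘ s → q ∣ₘ t → (p *ₘ q) ∣ₘ (s *ₘ t)
  *ₘ-mono-∣ₘ p∣s q∣t i j = +-mono-≤ (p∣s i j) (q∣t i j)

  ∣ₘ-respˡ-≈ₘ : {p q s : Monomial n} → p ≈ₘ q → p ∣ₘ s → q ∣ₘ s
  ∣ₘ-respˡ-≈ₘ p≈q p∣s i j = subst (_≤ _) (p≈q i j) (p∣s i j)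

  ∣ₘ-respʳ-≈ₘ : {p s t : Monomial n} → s ≈ₘ t → p ∣ₘ s → p ∣ₘ t
  ∣ₘ-respʳ-≈ₘ s≈t p∣s i j = subst (_ ≤_) (s≈t i j) (p∣s i j)

  ≉ₘ-by-entry : {s t : Monomial n} (i j : Fin n) → 1 ≤ s i j → t i j ≡ 0 → ¬ (s ≈ₘ t)
  ≉ₘ-by-entry i j 1≤sij tij≡0 s≈t with () ← subst (1 ≤_) (trans (s≈t i j) tij≡0) 1≤sij

  Joins : Fin n → Fin n → Fin n → Fin n → Set
  Joins u v i j = (u ≡ i × v ≡ j) ⊎ (u ≡ j × v ≡ i)

  joins? : ∀ u v i j → Dec (Joins u v i j)
  joins? u v i j = ((u ≟ i) ×-dec (v ≟ j)) ⊎-dec ((u ≟ j) ×-dec (v ≟ i))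

  edge : Fin n → Fin n → Monomial n
  edge u v i j = if does (joins? u v i j) then 1 else 0

  edge-sym : ∀ u v → edge u v ≈ₘ edge v u
  edge-sym u v i j =
    cong (λ b → if b then 1 else 0) (does-⇔ (mk⇔ flip flip) (joins? u v i j) (joins? v u i j))
    where
    flip : ∀ {u v} → Joins u v i j → Joins v u i j
    flip (inj₁ (u≡i , v≡j)) = inj₂ (v≡j , u≡i)
    flip (inj₂ (u≡j , v≡i)) = inj₁ (v≡i , u≡j)

  edge-self : ∀ u v → edge u v u v ≡ 1
  edge-self u v = cong (λ b → if b then 1 else 0) (dec-true (joins? u v u v) (inj₁ (refl , refl)))

  edge-absent : ∀ {u v} i {y} → y ≢ u → y ≢ v → edge u v i y ≡ 0
  edge-absent {u} {v} i {y} y≢u y≢v =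
    cong (λ b → if b then 1 else 0) (dec-false (joins? u v i y) not-joined)
    where
    not-joined : ¬ Joins u v i y
    not-joined (inj₁ (_ , v≡y)) = y≢v (sym v≡y)
    not-joined (inj₂ (u≡y , _)) = y≢u (sym u≡y)

  edgeProduct : ∀ {V} → (Fin V → Fin n) → List (Fin V × Fin V) → Monomial n
  edgeProduct φ []             i j = 0
  edgeProduct φ ((a , b) ∷ es) = edge (φ a) (φ b) *ₘ edgeProduct φ es

  homMonomial-edgeProduct : ∀ {V} es (φ : Fin V → Fin n) →
    homMonomial (mkGraph V es) n φ ≈ₘ edgeProduct φ es
  homMonomial-edgeProduct []             φ i j = refl
  homMonomial-edgeProduct ((a , b) ∷ es) φ i j =
    trans (length-filter-∷ _ (a , b) es) (cong (edge (φ a) (φ b) i j +_) (homMonomial-edgeProduct es φ i j))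

  path : Fin n → Fin n → Fin n → Monomial n
  path u v w = edge u v *ₘ edge v w

  path-sym : ∀ u v w → path u v w ≈ₘ path w v u
  path-sym u v w i j = begin
    edge u v i j + edge v w i j ≡⟨ +-comm (edge u v i j) _ ⟩
    edge v w i j + edge u v i j ≡⟨ cong₂ _+_ (edge-sym v w i j) (edge-sym u v i j) ⟩
    edge w v i j + edge v u i j ∎
    where open ≡-Reasoning

  cycle : Fin n → Fin n → Fin n → Fin n → Monomial n
  cycle a b c d = path a b c *ₘ path c d a

  cycle-rotate : ∀ a b c d → cycle a b c d ≈ₘ cycle b c d a
  cycle-rotate a b c d i j = rotate (edge a b i j) (edge b c i j) (edge c d i j) (edge d a i j)
    where
    rotate : ∀ p q r s → (p + q) + (r + s) ≡ (q + r) + (s + p)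
    rotate = solve-∀

  cycle-flip : ∀ a b c d → cycle a b c d ≈ₘ cycle a d c b
  cycle-flip a b c d i j = begin
    path a b c i j + path c d a i j ≡⟨ +-comm (path a b c i j) _ ⟩
    path c d a i j + path a b c i j ≡⟨ cong₂ _+_ (path-sym c d a i j) (path-sym a b c i j) ⟩
    path a d c i j + path c b a i j ∎
    where open ≡-Reasoning

  homMonomial-C4 : ∀ φ →
    homMonomial C4 n φ ≈ₘ cycle (φ zero) (φ (suc zero)) (φ (suc (suc zero))) (φ (suc (suc (suc zero))))
  homMonomial-C4 φ i j = trans (homMonomial-edgeProduct (E C4) φ i j)
    (regroup (edge a b i j) (edge b c i j) (edge c d i j) (edge d a i j))
    where
    a b c d : Fin n
    a = φ zero
    b = φ (suc zero)
    c = φ (suc (suc zero))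
    d = φ (suc (suc (suc zero)))
    regroup : ∀ p q r s → p + (q + (r + (s + 0))) ≡ (p + q) + (r + s)
    regroup = solve-∀

  walk : Fin n → Fin n → Fin n → Fin n → Fin 4 → Fin n
  walk a b c d zero                   = a
  walk a b c d (suc zero)             = b
  walk a b c d (suc (suc zero))       = c
  walk a b c d (suc (suc (suc zero))) = d

  cycle-isMonomialOfHom : ∀ {a b c d} → IsHom C4 n (walk a b c d) → IsMonomialOfHom C4 n (cycle a b c d)
  cycle-isMonomialOfHom {a} {b} {c} {d} hom = walk a b c d , hom , ≈ₘ-sym (homMonomial-C4 (walk a b c d))

  cycle-first-edge : ∀ a b c d → 1 ≤ cycle a b c d a b
  cycle-first-edge a b c d =
    subst (_≤ cycle a b c d a b) (edge-self a b)
      (≤-trans (m≤m+n (edge a b a b) (edge b c a b)) (m≤m+n (path a b c a b) (path c d a a b)))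

  cycle-third-edge : ∀ a b c d → 1 ≤ cycle a b c d c d
  cycle-third-edge a b c d =
    subst (_≤ cycle a b c d c d) (edge-self c d)
      (≤-trans (m≤m+n (edge c d c d) (edge d a c d)) (m≤n+m (path c d a c d) (path a b c c d)))

  cycle-absent : ∀ {a b c d y} i → y ≢ a → y ≢ b → y ≢ c → y ≢ d → cycle a b c d i y ≡ 0
  cycle-absent i y≢a y≢b y≢c y≢d =
    cong₂ _+_ (cong₂ _+_ (edge-absent i y≢a y≢b) (edge-absent i y≢b y≢c))
              (cong₂ _+_ (edge-absent i y≢c y≢d) (edge-absent i y≢d y≢a))

  path-∣-cycle : ∀ a c {b d x} → Among x b d → path a x c ∣ₘ cycle a b c d
  path-∣-cycle a c {b} {d} (inj₁ refl) = ∣ₘ-*ˡ (path a b c) (path c d a)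
  path-∣-cycle a c {b} {d} (inj₂ refl) = ∣ₘ-respˡ-≈ₘ (path-sym c d a) (∣ₘ-*ʳ (path a b c) (path c d a))

  Separated : Monomial n → Monomial n → Set
  Separated s t = ∀ m → IsMonomialOfHom C4 n m → m ∣ₘ (s *ₘ t) → (m ≈ₘ s) ⊎ (m ≈ₘ t)

  Separated-resp-≈ₘ : ∀ {s s′ t t′} → s ≈ₘ s′ → t ≈ₘ t′ → Separated s t → Separated s′ t′
  Separated-resp-≈ₘ s≈s′ t≈t′ sep m m-mon m∣s′t′ =
    Sum.map (λ m≈s → ≈ₘ-trans m≈s s≈s′) (λ m≈t → ≈ₘ-trans m≈t t≈t′)
      (sep m m-mon (∣ₘ-respʳ-≈ₘ (λ i j → sym (cong₂ _+_ (s≈s′ i j) (t≈t′ i j))) m∣s′t′))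

  crossing-not-separated : ∀ {a b c d e f} → IsHom C4 n (walk a b c d) → IsHom C4 n (walk a e c f) →
    Crossing b d e f → ¬ Separated (cycle a b c d) (cycle a e c f)
  crossing-not-separated {a} {b} {c} {d} {e} {f}
    (a≢b ∷ b≢c ∷ c≢d ∷ d≢a ∷ []) (a≢e ∷ e≢c ∷ c≢f ∷ f≢a ∷ [])
    (x , y , x∈bd , x∉ef , y∈ef , y∉bd) sep = [ m≉s , m≉t ]′ (sep m (cycle-isMonomialOfHom m-walk) m∣st)
    where
    x≢a : x ≢ a
    x≢a = among-≢ x∈bd (≢-sym a≢b) d≢a
    x≢c : x ≢ c
    x≢c = among-≢ x∈bd b≢c (≢-sym c≢d)
    y≢a : y ≢ a
    y≢a = among-≢ y∈ef (≢-sym a≢e) f≢a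
    y≢c : y ≢ c
    y≢c = among-≢ y∈ef e≢c (≢-sym c≢f)
    m : Monomial n
    m = cycle a x c y
    m-walk : IsHom C4 n (walk a x c y)
    m-walk = ≢-sym x≢a ∷ x≢c ∷ ≢-sym y≢c ∷ y≢a ∷ []
    m∣st : m ∣ₘ (cycle a b c d *ₘ cycle a e c f)
    m∣st = *ₘ-mono-∣ₘ {path a x c} {path c y a} {cycle a b c d} {cycle a e c f}
      (path-∣-cycle a c x∈bd) (∣ₘ-respˡ-≈ₘ (path-sym a y c) (path-∣-cycle a c y∈ef))
    m≉s : ¬ (m ≈ₘ cycle a b c d)
    m≉s = ≉ₘ-by-entry {m} {cycle a b c d} c y (cycle-third-edge a x c y)
      (cycle-absent c y≢a (y∉bd ∘ inj₁) y≢c (y∉bd ∘ inj₂))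
    m≉t : ¬ (m ≈ₘ cycle a e c f)
    m≉t = ≉ₘ-by-entry {m} {cycle a e c f} a x (cycle-first-edge a x c y)
      (cycle-absent a x≢a (x∉ef ∘ inj₁) x≢c (x∉ef ∘ inj₂))

  separated-common-diagonal : ∀ {a b c d e f} → IsHom C4 n (walk a b c d) → IsHom C4 n (walk a e c f) →
    b ≢ d → e ≢ f → Separated (cycle a b c d) (cycle a e c f) → cycle a b c d ≈ₘ cycle a e c f
  separated-common-diagonal {a} {b} {c} {d} s-walk t-walk b≢d e≢f sep
    with pairs-equal-or-crossing _≟_ b≢d e≢f
  ... | inj₁ (refl , refl)        = ≈ₘ-refl
  ... | inj₂ (inj₁ (refl , refl)) = cycle-flip a b c d
  ... | inj₂ (inj₂ crossing)      = ⊥-elim (crossing-not-separated s-walk t-walk crossing sep)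

  data NormalForm (s : Monomial n) : Set where
    diagonal    : ∀ {a b c d} → IsHom C4 n (walk a b c d) → b ≢ d → a ≤ᶠ c → s ≈ₘ cycle a b c d → NormalForm s
    doubledEdge : ∀ {a b} → a <ᶠ b → s ≈ₘ cycle a b a b → NormalForm s

  label : ∀ {s} → NormalForm s → Fin n × Fin n
  label (diagonal {a} {c = c} _ _ _ _) = a , c
  label (doubledEdge {a} {b} _ _)      = b , a

  NormalForm-resp-≈ₘ : ∀ {s t} → s ≈ₘ t → NormalForm t → NormalForm s
  NormalForm-resp-≈ₘ s≈t (diagonal w b≢d a≤c t≈) = diagonal w b≢d a≤c (≈ₘ-trans s≈t t≈)
  NormalForm-resp-≈ₘ s≈t (doubledEdge a<b t≈)    = doubledEdge a<b (≈ₘ-trans s≈t t≈)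

  normalForm-walk : ∀ {a b c d} → IsHom C4 n (walk a b c d) → NormalForm (cycle a b c d)
  normalForm-walk {a} {b} {c} {d} w@(a≢b ∷ b≢c ∷ c≢d ∷ d≢a ∷ [])
    with b ≟ d | ≤-total a c | a ≟ c | <-cmp a b
  ... | no b≢d  | inj₁ a≤c | _        | _            = diagonal w b≢d a≤c ≈ₘ-refl
  ... | no b≢d  | inj₂ c≤a | _        | _            =
    diagonal (c≢d ∷ d≢a ∷ a≢b ∷ b≢c ∷ []) (≢-sym b≢d) c≤a
      (≈ₘ-trans (cycle-rotate a b c d) (cycle-rotate b c d a))
  ... | yes refl | _       | no a≢c   | _            =
    diagonal (b≢c ∷ c≢d ∷ d≢a ∷ a≢b ∷ []) (≢-sym a≢c) ≤ᶠ-refl (cycle-rotate a b c d)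
  ... | yes refl | _       | yes refl | tri< a<b _ _ = doubledEdge a<b ≈ₘ-refl
  ... | yes refl | _       | yes refl | tri≈ _ a≡b _ = ⊥-elim (a≢b a≡b)
  ... | yes refl | _       | yes refl | tri> _ _ b<a = doubledEdge b<a (cycle-rotate a b a b)

  normalForm : ∀ {s} → IsMonomialOfHom C4 n s → NormalForm s
  normalForm (φ , (p ∷ q ∷ r ∷ u ∷ []) , s≈) =
    NormalForm-resp-≈ₘ (≈ₘ-trans s≈ (homMonomial-C4 φ)) (normalForm-walk (p ∷ q ∷ r ∷ u ∷ []))

  separated-same-label : ∀ {s t} (F : NormalForm s) (G : NormalForm t) →
    Separated s t → label F ≡ label G → s ≈ₘ t
  separated-same-label (diagonal s-walk b≢d _ s≈) (diagonal t-walk e≢f _ t≈) sep refl =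
    ≈ₘ-trans s≈ (≈ₘ-trans (separated-common-diagonal s-walk t-walk b≢d e≢f (Separated-resp-≈ₘ s≈ t≈ sep))
                          (≈ₘ-sym t≈))
  separated-same-label (diagonal _ _ a≤c _) (doubledEdge a′<b′ _) _ refl = ⊥-elim (<⇒≱ a′<b′ a≤c)
  separated-same-label (doubledEdge a<b _) (diagonal _ _ a′≤c′ _) _ refl = ⊥-elim (<⇒≱ a<b a′≤c′)
  separated-same-label (doubledEdge _ s≈) (doubledEdge _ t≈)      _ refl = ≈ₘ-trans s≈ (≈ₘ-sym t≈)

  code : ∀ {s} → IsMonomialOfHom C4 n s → Fin (n * n)
  code s-mon = uncurry combine (label (normalForm s-mon))

  code-separates : ∀ {s t} (s-mon : IsMonomialOfHom C4 n s) (t-mon : IsMonomialOfHom C4 n t) →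
    ¬ (s ≈ₘ t) × Separated s t → code s-mon ≢ code t-mon
  code-separates s-mon t-mon (s≉t , sep) code≡ =
    s≉t (separated-same-label (normalForm s-mon) (normalForm t-mon) sep (uncurry-combine-injective _ _ code≡))

separatingSet-length≤ : ∀ {n} {S : List (Monomial n)} → IsSeparatingSet C4 n S → length S ≤ n * n
separatingSet-length≤ (monomials , separated) =
  length≤-by-separating-label code code-separates monomials separated

mainTheorem5 : Σ ℕ λ N → ∀ n → N ≤ n → (S : List (Monomial n)) → IsSeparatingSet C4 n S → length S ≤ n ^ 2
mainTheorem5 = 0 , λ n _ S S-separating →
  subst (length S ≤_) (cong (n *_) (sym (*-identityʳ n))) (separatingSet-length≤ S-separating)
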